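{- Every labeled derivation in~$\mathsf{G3Kt}$ of a labeled polytree sequent $\mathcal{R},\Gamma$ consists solely of labeled polytree sequents.
   Context: Tense formulae: $A ::= p \mid \overline{p} \mid A\wedge A \mid A\vee A \mid \Box A \mid \Diamond A \mid \blacksquare A \mid \Diamond^{ - }A$, with $\Diamond^{ - }$ the past diamond. Labeled sequents $\mathcal{R},\Gamma$: $\mathcal{R}$ a set of relational atoms $Rxy$, $\Gamma$ a multiset of labeled formulae $x:A$. The graph of $\mathcal{R},\Gamma$ has the labels occurring in it as vertices, an edge $(x,y)$ for each $Rxy\in\mathcal{R}$, and vertex $x$ labeled by $\{A \mid x:A\in\Gamma\}$; a labeled polytree sequent is one whose graph has a tree as underlying undirected graph. $\mathsf{G3Kt}$ has rules: $(\textsf{id})$ $\mathcal{R},x:p,x:\overline{p},\Gamma$; $(\vee)$ from $\mathcal{R},x:A,x:B,\Gamma$ infer $\mathcal{R},x:A\vee B,\Gamma$; $(\wedge)$ from $\mathcal{R},x:A,\Gamma$ and $\mathcal{R},x:B,\Gamma$ infer $\mathcal{R},x:A\wedge B,\Gamma$; $(\Box)$ from $\mathcal{R},Rxy,y:A,\Gamma$ infer $\mathcal{R},x:\Box A,\Gamma$ ($y$ not in conclusion); $(\Diamond)$ from $\mathcal{R},Rxy,y:A,x:\Diamond A,\Gamma$ infer $\mathcal{R},Rxy,x:\Diamond A,\Gamma$; $(\blacksquare)$ from $\mathcal{R},Ryx,y:A,\Gamma$ infer $\mathcal{R},x:\blacksquare A,\Gamma$ ($y$ not in conclusion); $(\Diamond^{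 - })$ from $\mathcal{R},Ryx,y:A,x:\Diamond^{ - }A,\Gamma$ infer $\mathcal{R},Ryx,x:\Diamond^{ - }A,\Gamma$. -}

module Defs where

open import Data.Nat using (ℕ)
open import Data.Product using (_×_; _,_; proj₁; ∃; ∃-syntax)
open import Data.List using (List; []; _∷_; _++_; map; concatMap)
open import Data.List.Membership.Propositional using (_∈_; _∉_)
open import Data.List.Relation.Binary.Permutation.Propositional using (_↭_)
open import Data.List.Relation.Unary.Unique.Propositional using (Unique)
open import Data.Empty using (⊥)

-- Tense formulae in negation normal form; propositional variables are ℕ.
data Fm : Set where
  var  : ℕ → Fm
  nvar : ℕ → Fm
  _∧_  : Fm → Fm → Fm
  _∨_  : Fm → Fm → Fm
  □    : Fm → Fm
  ◇    : Fm → Fm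
  ■    : Fm → Fm
  ◇⁻   : Fm → Fm

Label : Set
Label = ℕ

-- Relational atom R x y is the pair (x , y).
RelAtom : Set
RelAtom = Label × Label

LFm : Set
LFm = Label × Fm

-- Labeled sequent R , Γ : the relational set R (as a list; only membership
-- matters) and the multiset Γ (as a list, taken up to permutation _↭_).
Seq : Set
Seq = List RelAtom × List LFm

labels : Seq → List Label
labels (R , Γ) = concatMap (λ e → proj₁ e ∷ Data.Product.proj₂ e ∷ []) R ++ map proj₁ Γ

Fresh : Label → Seq → Set
Fresh y S = y ∉ labels S

-- The calculus G3Kt. Principal formulae are located in the multiset Γ
-- via a permutation Γ ↭ (principal ∷ Δ).
data G3Kt : Seq → Set where
  idR  : ∀ {R Γ Δ x p} → Γ ↭ ((x , var p) ∷ (x , nvar p) ∷ Δ) → G3Kt (R , Γ)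
  ∨R   : ∀ {R Γ Δ x A B} → Γ ↭ ((x , A ∨ B) ∷ Δ) →
         G3Kt (R , (x , A) ∷ (x , B) ∷ Δ) → G3Kt (R , Γ)
  ∧R   : ∀ {R Γ Δ x A B} → Γ ↭ ((x , A ∧ B) ∷ Δ) →
         G3Kt (R , (x , A) ∷ Δ) → G3Kt (R , (x , B) ∷ Δ) → G3Kt (R , Γ)
  □R   : ∀ {R Γ Δ x y A} → Γ ↭ ((x , □ A) ∷ Δ) → Fresh y (R , Γ) →
         G3Kt ((x , y) ∷ R , (y , A) ∷ Δ) → G3Kt (R , Γ)
  ◇R   : ∀ {R Γ Δ x y A} → Γ ↭ ((x , ◇ A) ∷ Δ) → (x , y) ∈ R →
         G3Kt (R , (y , A) ∷ Γ) → G3Kt (R , Γ)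
  ■R   : ∀ {R Γ Δ x y A} → Γ ↭ ((x , ■ A) ∷ Δ) → Fresh y (R , Γ) →
         G3Kt ((y , x) ∷ R , (y , A) ∷ Δ) → G3Kt (R , Γ)
  ◇⁻R  : ∀ {R Γ Δ x y A} → Γ ↭ ((x , ◇⁻ A) ∷ Δ) → (y , x) ∈ R →
         G3Kt (R , (y , A) ∷ Γ) → G3Kt (R , Γ)

seqs : ∀ {S} → G3Kt S → List Seq
seqs {S} (idR _)      = S ∷ []
seqs {S} (∨R _ d)     = S ∷ seqs d
seqs {S} (∧R _ d e)   = S ∷ seqs d ++ seqs e
seqs {S} (□R _ _ d)   = S ∷ seqs d
seqs {S} (◇R _ _ d)   = S ∷ seqs d
seqs {S} (■R _ _ d)   = S ∷ seqs d
seqs {S} (◇⁻R _ _ d)  = S ∷ seqs d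

-- Walks in the underlying undirected (multi)graph of R: each relational atom
-- (a , b) ∈ R is an edge that may be traversed in either direction; the list
-- records the edges traversed.
data Walk (R : List RelAtom) : Label → Label → List RelAtom → Set where
  nil : ∀ {u} → Walk R u u []
  fwd : ∀ {u v w es} → (u , v) ∈ R → Walk R v w es → Walk R u w ((u , v) ∷ es)
  bwd : ∀ {u v w es} → (v , u) ∈ R → Walk R v w es → Walk R u w ((v , u) ∷ es)

Connected : Seq → Set
Connected (R , Γ) = ∀ u v → u ∈ labels (R , Γ) → v ∈ labels (R , Γ) →
                    ∃[ es ] Walk R u v es

-- acyclic: no closed walk of positive length with pairwise distinct edges
-- (a graph contains a cycle iff it has such a closed trail)
Acyclic : Seq → Set
Acyclic (R , Γ) = ∀ u e es → Walk R u u (e ∷ es) → Unique (e ∷ es) → ⊥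

-- polytree sequent: the underlying undirected graph is a tree
-- (nonempty, connected, acyclic)
Polytree : Seq → Set
Polytree S = (∃[ v ] v ∈ labels S) × Connected S × Acyclic S

-- Every rule of G3Kt either keeps the relational part R and only uses labels
-- that already occur in the conclusion, so connectivity and acyclicity are
-- inherited, or (□ and ■) adds one edge between an old label x and a fresh
-- label y, i.e. attaches a leaf to the tree. A leaf lies on no cycle: its only
-- edge would have to be traversed twice by a closed trail through it.
module Submission where

open import Defs
open import Data.Empty using (⊥; ⊥-elim)
open import Data.List using (List; []; _∷_; _++_; map; concatMap)
open import Data.List.Membership.Propositional using (_∈_; _∉_)
open import Data.List.Membership.Propositional.Properties using (∈-++⁺ˡ; ∈-++⁺ʳ; ∈-++⁻)
open import Data.List.Relation.Binary.Permutation.Propositional using (_↭_; ↭-sym)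
open import Data.List.Relation.Binary.Permutation.Propositional.Properties using (map⁺)
open import Data.List.Relation.Binary.Subset.Propositional using (_⊆_)
open import Data.List.Relation.Binary.Subset.Propositional.Properties
  using (⊆-reflexive-↭; ∷⁺ʳ; ∈-∷⁺ʳ; xs⊆ys++xs)
open import Data.List.Relation.Unary.All using (All; []; _∷_)
open import Data.List.Relation.Unary.All.Properties using (All¬⇒¬Any; ++⁺)
open import Data.List.Relation.Unary.AllPairs using (_∷_)
open import Data.List.Relation.Unary.Any using (here; there)
open import Data.List.Relation.Unary.Unique.Propositional using (Unique)
open import Data.Product using (_×_; _,_; proj₁; proj₂; ∃-syntax)
import Data.Product as Product
open import Data.Sum using (_⊎_; inj₁; inj₂; [_,_])
import Data.Sum as Sum
open import Function using (id; _∘_)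
open import Relation.Binary.PropositionalEquality using (_≡_; _≢_; refl)

relLabels : List RelAtom → List Label
relLabels = concatMap (λ e → proj₁ e ∷ proj₂ e ∷ [])

fmLabels : List LFm → List Label
fmLabels = map proj₁

Link : RelAtom → Label → Label → Set
Link f u v = f ≡ (u , v) ⊎ f ≡ (v , u)

link-sym : ∀ {f u v} → Link f u v → Link f v u
link-sym = Sum.swap

link-other-end : ∀ {e x y v} → x ≢ y → Link e x y → Link e y v → v ≡ x
link-other-end x≢y (inj₁ refl) (inj₁ refl) = ⊥-elim (x≢y refl)
link-other-end x≢y (inj₁ refl) (inj₂ refl) = refl
link-other-end x≢y (inj₂ refl) (inj₁ refl) = refl
link-other-end x≢y (inj₂ refl) (inj₂ refl) = ⊥-elim (x≢y refl)

link-touches : ∀ {e x y u v} → Link e x y → Link e u v → u ≡ y ⊎ v ≡ y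
link-touches (inj₁ refl) (inj₁ refl) = inj₂ refl
link-touches (inj₁ refl) (inj₂ refl) = inj₁ refl
link-touches (inj₂ refl) (inj₁ refl) = inj₁ refl
link-touches (inj₂ refl) (inj₂ refl) = inj₂ refl

edge-labels : ∀ {R a b} → (a , b) ∈ R → a ∈ relLabels R × b ∈ relLabels R
edge-labels (here refl) = here refl , there (here refl)
edge-labels (there p)   = Product.map (there ∘ there) (there ∘ there) (edge-labels p)

link-labels : ∀ {R f u v} → Link f u v → f ∈ R → u ∈ relLabels R × v ∈ relLabels R
link-labels (inj₁ refl) f∈R = edge-labels f∈R
link-labels (inj₂ refl) f∈R = Product.swap (edge-labels f∈R)

walk-edge : ∀ {R f u v} → Link f u v → f ∈ R → Walk R u v (f ∷ [])
walk-edge (inj₁ refl) f∈R = fwd f∈R nil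
walk-edge (inj₂ refl) f∈R = bwd f∈R nil

walk-uncons : ∀ {R u w f es} → Walk R u w (f ∷ es) →
              ∃[ v ] Link f u v × f ∈ R × Walk R v w es
walk-uncons (fwd f∈R W) = _ , inj₁ refl , f∈R , W
walk-uncons (bwd f∈R W) = _ , inj₂ refl , f∈R , W

walk-++ : ∀ {R u v w es fs} → Walk R u v es → Walk R v w fs → Walk R u w (es ++ fs)
walk-++ nil         W = W
walk-++ (fwd f∈R V) W = fwd f∈R (walk-++ V W)
walk-++ (bwd f∈R V) W = bwd f∈R (walk-++ V W)

walk-reverse : ∀ {R u w es} → Walk R u w es → ∃[ fs ] Walk R w u fs
walk-reverse nil         = _ , nil
walk-reverse (fwd f∈R W) = _ , walk-++ (proj₂ (walk-reverse W)) (bwd f∈R nil)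
walk-reverse (bwd f∈R W) = _ , walk-++ (proj₂ (walk-reverse W)) (fwd f∈R nil)

walk-weaken : ∀ {e R u w es} → Walk R u w es → Walk (e ∷ R) u w es
walk-weaken nil         = nil
walk-weaken (fwd f∈R W) = fwd (there f∈R) (walk-weaken W)
walk-weaken (bwd f∈R W) = bwd (there f∈R) (walk-weaken W)

walk-strengthen : ∀ {e R u w es} → Walk (e ∷ R) u w es → e ∈ es ⊎ Walk R u w es
walk-strengthen nil                 = inj₂ nil
walk-strengthen (fwd (here refl) W) = inj₁ (here refl)
walk-strengthen (fwd (there f∈R) W) = Sum.map there (fwd f∈R) (walk-strengthen W)
walk-strengthen (bwd (here refl) W) = inj₁ (here refl)
walk-strengthen (bwd (there f∈R) W) = Sum.map there (bwd f∈R) (walk-strengthen W)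

walk-from-isolated : ∀ {R y w es} → y ∉ relLabels R → Walk R y w es → w ≡ y
walk-from-isolated y∉R nil         = refl
walk-from-isolated y∉R (fwd f∈R _) = ⊥-elim (y∉R (proj₁ (edge-labels f∈R)))
walk-from-isolated y∉R (bwd f∈R _) = ⊥-elim (y∉R (proj₂ (edge-labels f∈R)))

connected-via : ∀ {R Γ} x → (∀ {u} → u ∈ labels (R , Γ) → ∃[ es ] Walk R u x es) →
                Connected (R , Γ)
connected-via x reach u v u∈ v∈ =
  _ , walk-++ (proj₂ (reach u∈)) (proj₂ (walk-reverse (proj₂ (reach v∈))))

module Pendant {R : List RelAtom} {e : RelAtom} {x y : Label}
               (link : Link e x y) (x≢y : x ≢ y) (y∉R : y ∉ relLabels R) where

  incident-is-pendant : ∀ {f v} → Link f y v → f ∈ e ∷ R → f ≡ e × v ≡ x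
  incident-is-pendant l (here refl) = refl , link-other-end x≢y link l
  incident-is-pendant l (there f∈R) = ⊥-elim (y∉R (proj₁ (link-labels l f∈R)))

  avoiding : ∀ {u w es} → e ∉ es → Walk (e ∷ R) u w es → Walk R u w es
  avoiding e∉es W = [ ⊥-elim ∘ e∉es , id ] (walk-strengthen W)

  trail-through-pendant : ∀ {u w es} → Walk (e ∷ R) u w es → Unique es → e ∈ es →
                          u ≡ y ⊎ w ≡ y
  trail-through-pendant W (f∉es ∷ un) e∈ with walk-uncons W | e∈
  ... | _ , l , _ , W' | here refl with link-touches link l
  ...   | inj₁ u≡y  = inj₁ u≡y
  ...   | inj₂ refl = inj₂ (walk-from-isolated y∉R (avoiding (All¬⇒¬Any f∉es) W'))
  trail-through-pendant W (f∉es ∷ un) e∈ | _ , l , f∈ , W' | there e∈es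
    with trail-through-pendant W' un e∈es
  ...   | inj₂ w≡y = inj₂ w≡y
  ...   | inj₁ refl with incident-is-pendant (link-sym l) f∈
  ...     | refl , _ = ⊥-elim (All¬⇒¬Any f∉es e∈es)

  no-closed-trail-at-pendant : ∀ {f es} → Walk (e ∷ R) y y (f ∷ es) → Unique (f ∷ es) → ⊥
  no-closed-trail-at-pendant W (f∉es ∷ _) with walk-uncons W
  ... | _ , l , f∈ , W' with incident-is-pendant l f∈
  ...   | refl , refl =
    x≢y (walk-from-isolated y∉R (proj₂ (walk-reverse (avoiding (All¬⇒¬Any f∉es) W'))))

  acyclic : ∀ {Γ Γ'} → Acyclic (R , Γ) → Acyclic (e ∷ R , Γ')
  acyclic acyc u f es W un with walk-strengthen W
  ... | inj₂ W' = acyc u f es W' un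
  ... | inj₁ e∈ with trail-through-pendant W un e∈
  ...   | inj₁ refl = no-closed-trail-at-pendant W un
  ...   | inj₂ refl = no-closed-trail-at-pendant W un

polytree-⊆ : ∀ {R Γ l Γ'} → Polytree (R , Γ) → fmLabels (l ∷ Γ') ⊆ labels (R , Γ) →
             Polytree (R , l ∷ Γ')
polytree-⊆ {R} {Γ} {l} {Γ'} (_ , conn , acyc) sub =
  (_ , ∈-++⁺ʳ (relLabels R) (here refl)) ,
  (λ u v u∈ v∈ → conn u v (old u∈) (old v∈)) ,
  acyc
  where
  old : labels (R , l ∷ Γ') ⊆ labels (R , Γ)
  old = [ ∈-++⁺ˡ , sub ] ∘ ∈-++⁻ (relLabels R)

labels-add-leaf : ∀ {R Γ Γ' e x y} → Link e x y → x ∈ labels (R , Γ) →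
                  fmLabels Γ' ⊆ y ∷ fmLabels Γ → labels (e ∷ R , Γ') ⊆ y ∷ labels (R , Γ)
labels-add-leaf (inj₁ refl) x∈ _ (here refl)         = there x∈
labels-add-leaf (inj₁ refl) _  _ (there (here refl)) = here refl
labels-add-leaf (inj₂ refl) _  _ (here refl)         = here refl
labels-add-leaf (inj₂ refl) x∈ _ (there (here refl)) = there x∈
labels-add-leaf {R} _ _ sub (there (there u∈)) with ∈-++⁻ (relLabels R) u∈
... | inj₁ u∈R = there (∈-++⁺ˡ u∈R)
... | inj₂ u∈Γ' with sub u∈Γ'
...   | here u≡y = here u≡y
...   | there u∈Γ = there (∈-++⁺ʳ (relLabels R) u∈Γ)

polytree-add-leaf : ∀ {R Γ Γ' e x y} → Polytree (R , Γ) → x ∈ labels (R , Γ) →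
                    Link e x y → x ≢ y → y ∉ relLabels R → fmLabels Γ' ⊆ y ∷ fmLabels Γ →
                    Polytree (e ∷ R , Γ')
polytree-add-leaf {R} {Γ} {Γ'} {e} {x} (_ , conn , acyc) x∈ link x≢y y∉R sub =
  (x , ∈-++⁺ˡ (proj₁ (link-labels {e ∷ R} link (here refl)))) ,
  connected-via x reach ,
  Pendant.acyclic link x≢y y∉R {Γ} {Γ'} acyc
  where
  reach : ∀ {u} → u ∈ labels (e ∷ R , Γ') → ∃[ es ] Walk (e ∷ R) u x es
  reach u∈ with labels-add-leaf {R} {Γ} {Γ'} link x∈ sub u∈
  ... | here refl   = _ , walk-edge (link-sym link) (here refl)
  ... | there u∈old = _ , walk-weaken (proj₂ (conn _ x u∈old x∈))

fmLabels-principal : ∀ {Γ Δ x C} → Γ ↭ (x , C) ∷ Δ → x ∷ fmLabels Δ ⊆ fmLabels Γ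
fmLabels-principal p = ⊆-reflexive-↭ (map⁺ proj₁ (↭-sym p))

principal-labels : ∀ {R Γ Δ x C} → Γ ↭ (x , C) ∷ Δ → x ∷ fmLabels Δ ⊆ labels (R , Γ)
principal-labels {R} p = ∈-++⁺ʳ (relLabels R) ∘ fmLabels-principal p

polytree-add-label : ∀ {R Γ y A} → Polytree (R , Γ) → y ∈ relLabels R → Polytree (R , (y , A) ∷ Γ)
polytree-add-label {R} {Γ} {y} {A} pt y∈R =
  polytree-⊆ {R} {Γ} {y , A} {Γ} pt (∈-∷⁺ʳ (∈-++⁺ˡ y∈R) (xs⊆ys++xs (fmLabels Γ) (relLabels R)))

polytree-fresh-leaf : ∀ {R Γ Δ e x y C A} → Polytree (R , Γ) → Γ ↭ (x , C) ∷ Δ →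
                      Fresh y (R , Γ) → Link e x y → Polytree (e ∷ R , (y , A) ∷ Δ)
polytree-fresh-leaf {R} {Γ} {Δ} {e} {x} {y} {C} {A} pt p fresh link =
  polytree-add-leaf {R} {Γ} {(y , A) ∷ Δ} pt x∈ link (λ { refl → fresh x∈ }) (fresh ∘ ∈-++⁺ˡ)
    (∷⁺ʳ y (fmLabels-principal p ∘ there))
  where
  x∈ : x ∈ labels (R , Γ)
  x∈ = principal-labels {R} p (here refl)

-- Polytree sees the formulas only through their labels, so the premise
-- sequents cannot be inferred and are passed explicitly.
lemma5p2 : ∀ {S} (d : G3Kt S) → Polytree S → All Polytree (seqs d)
lemma5p2 (idR _) pt = pt ∷ []
lemma5p2 {R , Γ} (∨R {Δ = Δ} {x = x} {A = A} {B = B} p d) pt =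
  pt ∷ lemma5p2 d (polytree-⊆ {R} {Γ} {x , A} {(x , B) ∷ Δ} pt
                     (∈-∷⁺ʳ (principal-labels {R} p (here refl)) (principal-labels {R} p)))
lemma5p2 {R , Γ} (∧R {Δ = Δ} {x = x} {A = A} {B = B} p d d') pt =
  pt ∷ ++⁺ (lemma5p2 d  (polytree-⊆ {R} {Γ} {x , A} {Δ} pt (principal-labels {R} p)))
           (lemma5p2 d' (polytree-⊆ {R} {Γ} {x , B} {Δ} pt (principal-labels {R} p)))
lemma5p2 {R , Γ} (◇R {y = y} {A = A} _ r d) pt =
  pt ∷ lemma5p2 d (polytree-add-label {R} {Γ} {y} {A} pt (proj₂ (edge-labels r)))
lemma5p2 {R , Γ} (◇⁻R {y = y} {A = A} _ r d) pt =
  pt ∷ lemma5p2 d (polytree-add-label {R} {Γ} {y} {A} pt (proj₁ (edge-labels r)))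
lemma5p2 {R , Γ} (□R {y = y} {A = A} p fresh d) pt =
  pt ∷ lemma5p2 d (polytree-fresh-leaf {R} {Γ} {y = y} {A = A} pt p fresh (inj₁ refl))
lemma5p2 {R , Γ} (■R {y = y} {A = A} p fresh d) pt =
  pt ∷ lemma5p2 d (polytree-fresh-leaf {R} {Γ} {y = y} {A = A} pt p fresh (inj₂ refl))
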